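{- Assume that for every universe \(\mathcal T\), the type \(\Omega_{\mathcal T}\) is \(\mathcal U_0\)-small. Then the following are equivalent for a poset \(X\) with carrier in a universe \(\mathcal U\): (i) \(X\) has suprema for all subsets (i.e. for all \(S:X\to\Omega_{\mathcal T}\), for every universe \(\mathcal T\)); (ii) \(X\) has suprema for all \(\mathcal U\)-covered subsets; (iii) \(X\) has suprema for all subsets whose total spaces are \(\mathcal U\)-small; (iv) \(X\) has suprema for all families \(I\to X\) with \(I:\mathcal U\).
   Context: Work in univalent foundations (intensional Martin-Löf type theory with universes, \(\mathcal U_0\) the first universe, function and propositional extensionality, propositional truncations). A type is \(\mathcal W\)-small if equivalent to a type in \(\mathcal W\). \(\Omega_{\mathcal T}\) is the type of propositions in \(\mathcal T\). A poset is a type with a proposition-valued reflexive, transitive, antisymmetric relation. A subset of \(X\) is a map \(S:X\to\Omega_{\mathcal T}\) for some universe \(\mathcal T\); its total space is \(\mathbb T(S):=\Sigma_{x:X}(x\in S)\); a supremum of \(S\) is a least upper bound of the elements in \(S\). \(S\) is \(\mathcal U\)-covered if there is a type \(I:\mathcal U\) with a surjection \(I\to\mathbb T(S)\). -}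

module Defs where

open import Level using (Level; _⊔_; 0ℓ; Setω) renaming (suc to lsuc)
open import Data.Product using (Σ; Σ-syntax; _,_; proj₁; proj₂; _×_)
open import Relation.Binary.PropositionalEquality using (_≡_)
open import Function.Bundles using (_↔_)
open import Axiom.Extensionality.Propositional using (Extensionality)

isProp : ∀ {ℓ} → Set ℓ → Set ℓ
isProp A = (x y : A) → x ≡ y

Ω : (t : Level) → Set (lsuc t)
Ω t = Σ[ P ∈ Set t ] isProp P

FunExt : Setω
FunExt = ∀ {a b} → Extensionality a b

PropExt : Setω
PropExt = ∀ {ℓ} {P Q : Set ℓ} → isProp P → isProp Q → (P → Q) → (Q → P) → P ≡ Q

record PropTrunc : Setω where
  field
    ∥_∥ : ∀ {ℓ} → Set ℓ → Set ℓ
    ∣_∣ : ∀ {ℓ} {A : Set ℓ} → A → ∥ A ∥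
    ∥∥-isProp : ∀ {ℓ} {A : Set ℓ} → isProp ∥ A ∥
    ∥∥-rec : ∀ {ℓ ℓ'} {A : Set ℓ} {P : Set ℓ'} → isProp P → (A → P) → ∥ A ∥ → P

IsSmall : ∀ {a} (w : Level) → Set a → Set (a ⊔ lsuc w)
IsSmall w A = Σ[ B ∈ Set w ] (B ↔ A)

record Poset (u v : Level) : Set (lsuc (u ⊔ v)) where
  field
    Carrier : Set u
    _⊑_ : Carrier → Carrier → Set v
    ⊑-prop : ∀ x y → isProp (x ⊑ y)
    ⊑-refl : ∀ x → x ⊑ x
    ⊑-trans : ∀ x y z → x ⊑ y → y ⊑ z → x ⊑ z
    ⊑-antisym : ∀ x y → x ⊑ y → y ⊑ x → x ≡ y

module _ {u v : Level} (X : Poset u v) where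
  open Poset X

  _∈_ : ∀ {t} → Carrier → (Carrier → Ω t) → Set t
  x ∈ S = proj₁ (S x)

  𝕋 : ∀ {t} → (Carrier → Ω t) → Set (u ⊔ t)
  𝕋 S = Σ[ x ∈ Carrier ] (x ∈ S)

  IsSupOf : ∀ {t} → (Carrier → Ω t) → Carrier → Set (u ⊔ v ⊔ t)
  IsSupOf S s = (∀ x → x ∈ S → x ⊑ s) × (∀ y → (∀ x → x ∈ S → x ⊑ y) → s ⊑ y)

  HasSup : ∀ {t} → (Carrier → Ω t) → Set (u ⊔ v ⊔ t)
  HasSup S = Σ[ s ∈ Carrier ] IsSupOf S s

  IsSupOfFam : ∀ {i} {I : Set i} → (I → Carrier) → Carrier → Set (u ⊔ v ⊔ i)
  IsSupOfFam {I = I} α s = (∀ k → α k ⊑ s) × (∀ y → (∀ k → α k ⊑ y) → s ⊑ y)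

  HasSupFam : ∀ {i} {I : Set i} → (I → Carrier) → Set (u ⊔ v ⊔ i)
  HasSupFam α = Σ[ s ∈ Carrier ] IsSupOfFam α s

  SupAllSubsets : Setω
  SupAllSubsets = ∀ {t} (S : Carrier → Ω t) → HasSup S

  module _ (pt : PropTrunc) where
    open PropTrunc pt

    isSurjection : ∀ {a b} {A : Set a} {B : Set b} → (A → B) → Set (a ⊔ b)
    isSurjection {A = A} f = ∀ y → ∥ Σ[ a ∈ A ] (f a ≡ y) ∥

    IsCovered : ∀ {t} → (Carrier → Ω t) → Set (lsuc u ⊔ t)
    IsCovered S = Σ[ I ∈ Set u ] Σ[ f ∈ (I → 𝕋 S) ] isSurjection f

    SupCoveredSubsets : Setω
    SupCoveredSubsets = ∀ {t} (S : Carrier → Ω t) → IsCovered S → HasSup S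

  SupSmallSubsets : Setω
  SupSmallSubsets = ∀ {t} (S : Carrier → Ω t) → IsSmall u (𝕋 S) → HasSup S

  SupSmallFamilies : Set (lsuc u ⊔ v)
  SupSmallFamilies = (I : Set u) (α : I → Carrier) → HasSupFam α

record TFAE₄ (A B C : Setω) {d : Level} (D : Set d) : Setω where
  field
    i⇒ii : A → B
    ii⇒iii : B → C
    iii⇒iv : C → D
    iv⇒i : D → A

{-# OPTIONS --safe #-}
module Submission where

open import Defs
open import Level using (Level; 0ℓ; _⊔_; Lift; lift)
open import Data.Unit using (⊤; tt)
open import Data.Product using (Σ; _,_; proj₁; proj₂; map₂)
open import Function using (_∘_)
open import Function.Bundles using (_↔_; _⇔_; mk⇔; Equivalence; Inverse; Injection)
open import Function.Properties.Inverse using (↔-refl; ↔-sym; ↔⇒↣)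
open import Relation.Binary.PropositionalEquality using (_≡_; refl; cong; subst; sym)
open import Axiom.UniquenessOfIdentityProofs.WithK using (uip)

-- (i) ⇒ (ii) ⇒ (iii) ⇒ (iv) are weakenings: a small total space covers itself, and a family
-- indexed by I : 𝒰 has the same upper bounds as its image, whose total space lives in 𝒰.
-- For (iv) ⇒ (i), smallness of Ω resizes any subset S to an equivalent 𝒰₀-valued predicate R;
-- the family proj₁ : Σ X R → X is then indexed by a type in 𝒰, and its supremum is one of S.

module _ (fe : FunExt) (pe : PropExt) where

  Ω-ext : ∀ {t} {P Q : Ω t} → (proj₁ P → proj₁ Q) → (proj₁ Q → proj₁ P) → P ≡ Q
  Ω-ext {P = P , P-prop} {Q = Q , Q-prop} f g with pe P-prop Q-prop f g
  ... | refl = cong (P ,_) (fe λ x → fe λ y → uip (P-prop x y) (Q-prop x y))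

  ⊤Ω : ∀ {t} → Ω t
  ⊤Ω {t} = Lift t ⊤ , λ _ _ → refl

  holds⇔≡⊤Ω : ∀ {t} (P : Ω t) → proj₁ P ⇔ (P ≡ ⊤Ω)
  holds⇔≡⊤Ω P = mk⇔ (λ p → Ω-ext (λ _ → lift tt) (λ _ → p))
                    (λ P≡⊤ → subst proj₁ (sym P≡⊤) (lift tt))

  module _ {t w : Level} (Ω-small : IsSmall w (Ω t)) where

    private
      e : Ω t ↔ proj₁ Ω-small
      e = ↔-sym (proj₂ Ω-small)

    Resized : Ω t → Set w
    Resized P = Inverse.to e P ≡ Inverse.to e ⊤Ω

    holds⇔Resized : (P : Ω t) → proj₁ P ⇔ Resized P
    holds⇔Resized P = mk⇔
      (cong (Inverse.to e) ∘ Equivalence.to (holds⇔≡⊤Ω P))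
      (Equivalence.from (holds⇔≡⊤Ω P) ∘ Injection.injective (↔⇒↣ e))

module _ {u v : Level} (X : Poset u v) where
  open Poset X

  IsSupOfFam-proj₁⇒IsSupOf : ∀ {t r} (S : Carrier → Ω t) {R : Carrier → Set r}
    → (∀ x → proj₁ (S x) ⇔ R x)
    → ∀ {s} → IsSupOfFam X (proj₁ {B = R}) s → IsSupOf X S s
  IsSupOfFam-proj₁⇒IsSupOf S S⇔R (upper , least) =
      (λ x x∈S → upper (x , Equivalence.to (S⇔R x) x∈S))
    , (λ y y-upper → least y λ (x , Rx) → y-upper x (Equivalence.from (S⇔R x) Rx))

  module _ (pt : PropTrunc) where
    open PropTrunc pt

    image : ∀ {i} {I : Set i} → (I → Carrier) → Carrier → Ω (u ⊔ i)
    image {I = I} α x = ∥ Σ I (λ k → α k ≡ x) ∥ , ∥∥-isProp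

    IsSupOf-image⇒IsSupOfFam : ∀ {i} {I : Set i} (α : I → Carrier)
      → ∀ {s} → IsSupOf X (image α) s → IsSupOfFam X α s
    IsSupOf-image⇒IsSupOfFam α (upper , least) =
        (λ k → upper (α k) ∣ k , refl ∣)
      , (λ y y-upper → least y λ x → ∥∥-rec (⊑-prop x y) λ { (k , refl) → y-upper k })

    small⇒covered : ∀ {t} (S : Carrier → Ω t) → IsSmall u (𝕋 X S) → IsCovered X pt S
    small⇒covered S (I , e) =
      I , Inverse.to e , λ y → ∣ Inverse.from e y , Inverse.strictlyInverseˡ e y ∣

theorem6p9 : FunExt → PropExt → (pt : PropTrunc)
    → (∀ {t} → IsSmall 0ℓ (Ω t))
    → ∀ {u v} (X : Poset u v)
    → TFAE₄ (SupAllSubsets X) (SupCoveredSubsets X pt) (SupSmallSubsets X) (SupSmallFamilies X)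
theorem6p9 fe pe pt Ω-small X = record
  { i⇒ii = λ sup S _ → sup S
  ; ii⇒iii = λ sup S S-small → sup S (small⇒covered X pt S S-small)
  ; iii⇒iv = λ sup I α →
      map₂ (IsSupOf-image⇒IsSupOfFam X pt α) (sup (image X pt α) (_ , ↔-refl))
  ; iv⇒i = λ sup S →
      map₂ (IsSupOfFam-proj₁⇒IsSupOf X S (holds⇔Resized fe pe Ω-small ∘ S))
           (sup (Σ (Poset.Carrier X) (Resized fe pe Ω-small ∘ S)) proj₁)
  }
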